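{- For every graph $\Gamma$ there exists a graph $\Gamma'$ such that $\Gamma'$ admits a partial orientation as a quasi-transitive mixed graph and $\Gamma$ is an induced subgraph of $\Gamma'$.
   Context: A mixed graph has a vertex set, a set of (undirected) edges and a set of arcs, with at most one edge or arc between any pair of vertices. A partial orientation of a graph $\Gamma$ is a mixed graph obtained from $\Gamma$ by orienting some (possibly none or all) of its edges as arcs. A $2$-dipath is a directed path $uvw$ consisting of arcs $u\to v$ and $v\to w$; it is induced if $u$ and $w$ are not joined by an edge or arc. A mixed graph $H$ is quasi-transitive when (1) $H$ has no induced $2$-dipath, and (2) for every edge $uv$ of $H$ there is a vertex $w$ such that $uwv$ or $vwu$ is a $2$-dipath. -}

module Defs where

open import Data.Nat using (ℕ)
open import Data.Fin using (Fin)
open import Data.Bool using (Bool; true; false)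
open import Data.Product using (Σ; ∃; _×_; _,_)
open import Data.Sum using (_⊎_)
open import Relation.Binary.PropositionalEquality using (_≡_; _≢_)
open import Relation.Nullary using (¬_)
open import Function.Definitions using (Injective)

record Graph : Set where
  field
    n     : ℕ
    adj   : Fin n → Fin n → Bool
    sym   : ∀ u v → adj u v ≡ adj v u
    irrefl : ∀ u → adj u u ≡ false
open Graph public

-- Edges of Γ not oriented remain (undirected) edges of the mixed graph.
record PartialOrientation (Γ : Graph) : Set where
  field
    arc       : Fin (n Γ) → Fin (n Γ) → Bool
    arc⇒adj   : ∀ u v → arc u v ≡ true → adj Γ u v ≡ true
    antisym   : ∀ u v → arc u v ≡ true → arc v u ≡ false
open PartialOrientation public

module _ {Γ : Graph} (D : PartialOrientation Γ) where
  IsEdge : Fin (n Γ) → Fin (n Γ) → Set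
  IsEdge u v = adj Γ u v ≡ true × arc D u v ≡ false × arc D v u ≡ false

  TwoDipath : Fin (n Γ) → Fin (n Γ) → Fin (n Γ) → Set
  TwoDipath u v w = arc D u v ≡ true × arc D v w ≡ true

  QuasiTransitive : Set
  QuasiTransitive =
    (∀ u v w → TwoDipath u v w → u ≢ w → adj Γ u w ≡ true)
    × (∀ u v → IsEdge u v → ∃ λ w → TwoDipath u w v ⊎ TwoDipath v w u)

AdmitsQTOrientation : Graph → Set
AdmitsQTOrientation Γ = Σ (PartialOrientation Γ) QuasiTransitive

InducedSubgraph : Graph → Graph → Set
InducedSubgraph Γ Γ' =
  Σ (Fin (n Γ) → Fin (n Γ')) λ f →
    Injective _≡_ _≡_ f × (∀ u v → adj Γ' (f u) (f v) ≡ adj Γ u v)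

module Submission where

-- Take two copies u₁ and u₂ of each vertex u of Γ. Inside each copy keep the
-- edges of Γ unoriented; add the arcs u₁ → u₂ and, for every edge uv of Γ,
-- u₂ → v₁. The first copy is an induced copy of Γ. Every 2-dipath is
-- u₁ → u₂ → v₁ or u₂ → v₁ → v₂ with uv an edge, so its ends are adjacent, and
-- the only unoriented edges u₁v₁ and u₂v₂ lie under u₁ → u₂ → v₁ and
-- u₂ → v₁ → v₂.

open import Defs hiding (sym; arc)
open import Data.Product using (Σ; ∃; _×_; _,_)
open import Data.Nat using (ℕ)
open import Data.Fin using (Fin; splitAt; join; _↑ˡ_)
open import Data.Fin.Properties using (_≟_; splitAt-↑ˡ; splitAt-join; ↑ˡ-injective)
open import Data.Bool using (Bool; true; false; _∨_)
open import Data.Bool.Properties using (∨-zeroʳ)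
open import Data.Sum using (_⊎_; inj₁; inj₂)
open import Relation.Nullary using (Dec; yes; no; does; contradiction)
open import Relation.Nullary.Decidable using (dec-true; dec-false)
open import Relation.Binary.PropositionalEquality
  using (_≡_; _≢_; refl; sym; trans; cong₂; subst)

does-true⇒ : ∀ {a} {A : Set a} (a? : Dec A) → does a? ≡ true → A
does-true⇒ (yes a) _ = a

adj⇒≢ : (Γ : Graph) → ∀ {u v} → adj Γ u v ≡ true → u ≢ v
adj⇒≢ Γ {u} uv refl = contradiction (trans (sym uv) (irrefl Γ u)) λ ()

adj⁼ : (Γ : Graph) → Fin (n Γ) → Fin (n Γ) → Bool
adj⁼ Γ u v = does (u ≟ v) ∨ adj Γ u v

adj⁼-sym : (Γ : Graph) → ∀ u v → adj⁼ Γ u v ≡ adj⁼ Γ v u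
adj⁼-sym Γ u v = cong₂ _∨_ (≟-sym u v) (Graph.sym Γ u v)
  where
  ≟-sym : ∀ u v → does (u ≟ v) ≡ does (v ≟ u)
  ≟-sym u v with u ≟ v
  ... | yes refl = sym (dec-true (u ≟ u) refl)
  ... | no u≢v   = sym (dec-false (v ≟ u) λ v≡u → u≢v (sym v≡u))

LiesUnder2Dipath : {V : Set} → (V → V → Bool) → V → V → V → Set
LiesUnder2Dipath arc u v w = (arc u w ≡ true × arc w v ≡ true) ⊎ (arc v w ≡ true × arc w u ≡ true)

record QTMixedGraphOn (V : Set) : Set where
  field
    adjacent          : V → V → Bool
    arc               : V → V → Bool
    adjacent-sym      : ∀ u v → adjacent u v ≡ adjacent v u
    adjacent-irrefl   : ∀ u → adjacent u u ≡ false
    arc⇒adjacent      : ∀ u v → arc u v ≡ true → adjacent u v ≡ true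
    arc-antisym       : ∀ u v → arc u v ≡ true → arc v u ≡ false
    2-dipath⇒adjacent : ∀ u v w → arc u v ≡ true → arc v w ≡ true → adjacent u w ≡ true
    edge⇒2-dipath     : ∀ u v → adjacent u v ≡ true → arc u v ≡ false → arc v u ≡ false →
                        ∃ (LiesUnder2Dipath arc u v)

-- The section g of f is needed only to transport the 2-dipaths covering edges.
module Relabel {V : Set} (H : QTMixedGraphOn V) {m : ℕ}
               (f : Fin m → V) (g : V → Fin m) (f∘g : ∀ v → f (g v) ≡ v) where
  open QTMixedGraphOn H

  graph : Graph
  graph = record
    { n      = m
    ; adj    = λ x y → adjacent (f x) (f y)
    ; sym    = λ x y → adjacent-sym (f x) (f y)
    ; irrefl = λ x → adjacent-irrefl (f x)
    }

  orientation : PartialOrientation graph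
  orientation = record
    { arc     = λ x y → arc (f x) (f y)
    ; arc⇒adj = λ x y → arc⇒adjacent (f x) (f y)
    ; antisym = λ x y → arc-antisym (f x) (f y)
    }

  quasiTransitive : QuasiTransitive orientation
  quasiTransitive =
      (λ x y z (xy , yz) _ → 2-dipath⇒adjacent (f x) (f y) (f z) xy yz)
    , λ x y (xy , x↛y , y↛x) → covering x y (edge⇒2-dipath (f x) (f y) xy x↛y y↛x)
    where
    covering : ∀ x y → ∃ (LiesUnder2Dipath arc (f x) (f y)) →
               ∃ λ z → TwoDipath orientation x z y ⊎ TwoDipath orientation y z x
    covering x y (w , path) = g w , subst (LiesUnder2Dipath arc (f x) (f y)) (sym (f∘g w)) path

module Doubling (Γ : Graph) where
  V : Set
  V = Fin (n Γ) ⊎ Fin (n Γ)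

  adjacent : V → V → Bool
  adjacent (inj₁ u) (inj₁ v) = adj Γ u v
  adjacent (inj₁ u) (inj₂ v) = adj⁼ Γ u v
  adjacent (inj₂ u) (inj₁ v) = adj⁼ Γ u v
  adjacent (inj₂ u) (inj₂ v) = adj Γ u v

  arc : V → V → Bool
  arc (inj₁ u) (inj₁ v) = false
  arc (inj₁ u) (inj₂ v) = does (u ≟ v)
  arc (inj₂ u) (inj₁ v) = adj Γ u v
  arc (inj₂ u) (inj₂ v) = false

  adjacent-sym : ∀ u v → adjacent u v ≡ adjacent v u
  adjacent-sym (inj₁ u) (inj₁ v) = Graph.sym Γ u v
  adjacent-sym (inj₁ u) (inj₂ v) = adj⁼-sym Γ u v
  adjacent-sym (inj₂ u) (inj₁ v) = adj⁼-sym Γ u v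
  adjacent-sym (inj₂ u) (inj₂ v) = Graph.sym Γ u v

  adjacent-irrefl : ∀ u → adjacent u u ≡ false
  adjacent-irrefl (inj₁ u) = irrefl Γ u
  adjacent-irrefl (inj₂ u) = irrefl Γ u

  arc⇒adjacent : ∀ u v → arc u v ≡ true → adjacent u v ≡ true
  arc⇒adjacent (inj₁ u) (inj₂ v) u≡v = cong₂ _∨_ u≡v refl
  arc⇒adjacent (inj₂ u) (inj₁ v) uv  = trans (cong₂ _∨_ refl uv) (∨-zeroʳ _)

  arc-antisym : ∀ u v → arc u v ≡ true → arc v u ≡ false
  arc-antisym (inj₁ u) (inj₂ v) u≡v with refl ← does-true⇒ (u ≟ v) u≡v = irrefl Γ u
  arc-antisym (inj₂ u) (inj₁ v) uv  = dec-false (v ≟ u) (λ v≡u → adj⇒≢ Γ uv (sym v≡u))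

  2-dipath⇒adjacent : ∀ u v w → arc u v ≡ true → arc v w ≡ true → adjacent u w ≡ true
  2-dipath⇒adjacent (inj₁ u) (inj₂ v) (inj₁ w) u≡v vw with refl ← does-true⇒ (u ≟ v) u≡v = vw
  2-dipath⇒adjacent (inj₂ u) (inj₁ v) (inj₂ w) uv v≡w with refl ← does-true⇒ (v ≟ w) v≡w = uv

  edge⇒2-dipath : ∀ u v → adjacent u v ≡ true → arc u v ≡ false → arc v u ≡ false →
                  ∃ (LiesUnder2Dipath arc u v)
  edge⇒2-dipath (inj₁ u) (inj₁ v) uv _ _ = inj₂ u , inj₁ (dec-true (u ≟ u) refl , uv)
  edge⇒2-dipath (inj₂ u) (inj₂ v) uv _ _ = inj₁ v , inj₁ (uv , dec-true (v ≟ v) refl)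
  edge⇒2-dipath (inj₁ u) (inj₂ v) uv u↛v v↛u rewrite u↛v
    with () ← trans (sym v↛u) (trans (Graph.sym Γ v u) uv)
  edge⇒2-dipath (inj₂ u) (inj₁ v) uv u↛v v↛u rewrite adj⁼-sym Γ u v | v↛u
    with () ← trans (sym u↛v) (trans (Graph.sym Γ u v) uv)

  doubling : QTMixedGraphOn V
  doubling = record
    { adjacent          = adjacent
    ; arc               = arc
    ; adjacent-sym      = adjacent-sym
    ; adjacent-irrefl   = adjacent-irrefl
    ; arc⇒adjacent      = arc⇒adjacent
    ; arc-antisym       = arc-antisym
    ; 2-dipath⇒adjacent = 2-dipath⇒adjacent
    ; edge⇒2-dipath     = edge⇒2-dipath
    }

  open Relabel doubling (splitAt (n Γ)) (join (n Γ) (n Γ)) (splitAt-join (n Γ) (n Γ)) public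

  firstCopy-induced : InducedSubgraph Γ graph
  firstCopy-induced = (_↑ˡ n Γ) , ↑ˡ-injective (n Γ) _ _ , adj-↑ˡ
    where
    adj-↑ˡ : ∀ u v → adjacent (splitAt (n Γ) (u ↑ˡ n Γ)) (splitAt (n Γ) (v ↑ˡ n Γ)) ≡ adj Γ u v
    adj-↑ˡ u v rewrite splitAt-↑ˡ (n Γ) u (n Γ) | splitAt-↑ˡ (n Γ) v (n Γ) = refl

theorem2p1 : (Γ : Graph) → Σ Graph (λ Γ' → AdmitsQTOrientation Γ' × InducedSubgraph Γ Γ')
theorem2p1 Γ = graph , (orientation , quasiTransitive) , firstCopy-induced
  where open Doubling Γ
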